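{- Let $m\in Mon_F$ be in open normal form, $s\in Act^*$ and $x\in Var$. If $m\xrightarrow{s}x+m_s$ for some $m_s$, then $\mathcal{E}_v\vdash m=m'+s.x$ for some monitor $m'$ such that there is no $m''$ with $m'\xrightarrow{s}x+m''$.
   Context: Fix a set $Act$ of visible actions, a symbol $\tau\notin Act$, and a countably infinite set $Var$ of variables. Monitors $Mon_F$: $m,n ::= v \mid a.m \mid m+n \mid x$ ($a\in Act$, $x\in Var$), verdicts $v ::= \mathit{end}\mid \mathit{yes}\mid \mathit{no}$. $\sum_{i\in I}m_i$ is $\mathit{end}$ if $I=\emptyset$ and $m_{i_1}+\cdots+m_{i_k}$ otherwise; $m\,[+v]$ means $v$ is an optional summand. Terms are considered up to A1–A4 below (so $m\xrightarrow{s}x+m_s$ means $m$ reaches, via $s$, a term having $x$ as a summand). For $s=a_1\cdots a_k$, $s.m$ denotes $a_1.\cdots a_k.m$. Transitions: for $\alpha\in Act\cup\{\tau\}$, $\xrightarrow{\alpha}$ is the least relation with $a.m\xrightarrow{a}m$; if $m\xrightarrow{\alpha}m'$ then $m+n\xrightarrow{\alpha}m'$ and $n+m\xrightarrow{\alpha}m'$; and $v\xrightarrow{\alpha}v$ for every verdict $v$ and every $\alpha$; for $s=a_1\cdots a_k$, $m\xrightarrow{s}m'$ iff $m=m_0\xrightarrow{a_1}m_1\cdots\xrightarrow{a_k}m_k=m'$. An open normal form is a term $\sum_{a\in A}a.m_a+\sum_{i\in I}x_i\,[+\mathit{yes}]\,[+\mathit{no}]$, where $\{x_i\mid i\in I\}$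 is a finite set of variables, $A$ is a finite subset of $Act$, and each $m_a$ is an open normal form different from $\mathit{end}$. $\mathcal{E}\vdash m=n$: derivability by reflexivity, symmetry, transitivity, substitutivity and congruence for $a.\_$ and $+$. $\mathcal{E}_v$: (A1) $x+y=y+x$; (A2) $x+(y+z)=(x+y)+z$; (A3) $x+x=x$; (A4) $x+\mathit{end}=x$; for each $a\in Act$: $(E_a)$ $a.\mathit{end}=\mathit{end}$; $(Y_a)$ $\mathit{yes}=\mathit{yes}+a.\mathit{yes}$; $(N_a)$ $\mathit{no}=\mathit{no}+a.\mathit{no}$; $(D_a)$ $a.(x+y)=a.x+a.y$. -}

module Defs where

open import Data.Nat using (ℕ)
open import Data.Bool using (Bool; true; false)
open import Data.Maybe using (Maybe; just; nothing)
open import Data.List using (List; []; _∷_; map; foldr)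
open import Data.Product using (_×_; _,_; proj₁; proj₂)
open import Data.List.Relation.Unary.All using (All)
open import Data.List.Relation.Unary.Unique.Propositional using (Unique)
open import Relation.Nullary using (¬_)

Var : Set
Var = ℕ

data Verdict : Set where
  end yes no : Verdict

module Monitors (Act : Set) where

  infixr 6 _·_
  infixl 5 _⊕_

  data Mon : Set where
    verd : Verdict → Mon
    _·_  : Act → Mon → Mon
    _⊕_  : Mon → Mon → Mon
    var  : Var → Mon

  endM yesM noM : Mon
  endM = verd end
  yesM = verd yes
  noM  = verd no

  -- Labels: visible actions, or τ (= nothing)
  Label : Set
  Label = Maybe Act

  data _─[_]→_ : Mon → Label → Mon → Set where
    pre  : ∀ {a m} → (a · m) ─[ just a ]→ m
    sumL : ∀ {m n α m'} → m ─[ α ]→ m' → (m ⊕ n) ─[ α ]→ m'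
    sumR : ∀ {m n α m'} → m ─[ α ]→ m' → (n ⊕ m) ─[ α ]→ m'
    vrd  : ∀ {v α} → verd v ─[ α ]→ verd v

  data _═[_]⇒_ : Mon → List Act → Mon → Set where
    done : ∀ {m} → m ═[ [] ]⇒ m
    step : ∀ {m a s m₁ m'} → m ─[ just a ]→ m₁ → m₁ ═[ s ]⇒ m' → m ═[ a ∷ s ]⇒ m'

  _∙_ : List Act → Mon → Mon
  s ∙ m = foldr _·_ m s

  Subst : Set
  Subst = Var → Mon

  _[_] : Mon → Subst → Mon
  verd v [ σ ] = verd v
  (a · m) [ σ ] = a · (m [ σ ])
  (m ⊕ n) [ σ ] = (m [ σ ]) ⊕ (n [ σ ])
  var x [ σ ] = σ x

  data _⊢_≈_ (Ax : Mon → Mon → Set) : Mon → Mon → Set where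
    ax    : ∀ {m n} → Ax m n → Ax ⊢ m ≈ n
    refl  : ∀ {m} → Ax ⊢ m ≈ m
    sym   : ∀ {m n} → Ax ⊢ m ≈ n → Ax ⊢ n ≈ m
    trans : ∀ {m n k} → Ax ⊢ m ≈ n → Ax ⊢ n ≈ k → Ax ⊢ m ≈ k
    subst : ∀ {m n} (σ : Subst) → Ax ⊢ m ≈ n → Ax ⊢ (m [ σ ]) ≈ (n [ σ ])
    cong· : ∀ {m n} (a : Act) → Ax ⊢ m ≈ n → Ax ⊢ (a · m) ≈ (a · n)
    cong⊕ : ∀ {m m' n n'} → Ax ⊢ m ≈ m' → Ax ⊢ n ≈ n' → Ax ⊢ (m ⊕ n) ≈ (m' ⊕ n')

  private
    x y z : Mon
    x = var 0
    y = var 1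
    z = var 2

  data ACI : Mon → Mon → Set where
    A1 : ACI (x ⊕ y) (y ⊕ x)
    A2 : ACI (x ⊕ (y ⊕ z)) ((x ⊕ y) ⊕ z)
    A3 : ACI (x ⊕ x) x
    A4 : ACI (x ⊕ endM) x

  data Ev : Mon → Mon → Set where
    aci : ∀ {m n} → ACI m n → Ev m n
    Ea  : (a : Act) → Ev (a · endM) endM
    Ya  : (a : Act) → Ev yesM (yesM ⊕ (a · yesM))
    Na  : (a : Act) → Ev noM (noM ⊕ (a · noM))
    Da  : (a : Act) → Ev (a · (x ⊕ y)) ((a · x) ⊕ (a · y))

  Σ' : List Mon → Mon
  Σ' [] = endM
  Σ' (m ∷ []) = m
  Σ' (m ∷ ms@(_ ∷ _)) = m ⊕ Σ' ms

  opt : Bool → Verdict → Mon → Mon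
  opt true  v m = m ⊕ verd v
  opt false v m = m

  canon : List (Act × Mon) → List Var → Bool → Bool → Mon
  canon ps xs by bn =
    opt bn no (opt by yes (Σ' (map (λ p → proj₁ p · proj₂ p) ps) ⊕ Σ' (map var xs)))

  data IsONF (m : Mon) : Set where
    onf : (ps : List (Act × Mon)) → Unique (map proj₁ ps)
        → All (λ p → ¬ (ACI ⊢ proj₂ p ≈ endM)) ps
        → All (λ p → IsONF (proj₂ p)) ps
        → (xs : List Var) → Unique xs
        → (by bn : Bool)
        → ACI ⊢ m ≈ canon ps xs by bn
        → IsONF m

  ReachesVar : Mon → List Act → Var → Set
  ReachesVar m s x = Σ Mon λ ms → Σ Mon λ t → (m ═[ s ]⇒ t) × (ACI ⊢ t ≈ (var x ⊕ ms))
    where open import Data.Product using (Σ)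

-- Induction on s: for s = [] the
-- variable x is one of the summands and is removed; for s = a s′ the trace enters the unique
-- summand a.mₐ, the induction hypothesis gives mₐ = m′ₐ + s′.x, and D_a turns a.(m′ₐ + s′.x)
-- into a.m′ₐ + s.x. Distinctness makes the remainder unable to reach x along s. Transporting
-- reachability along ACI rests on a simulation up to ACI that also preserves top-level variables.

module Submission where

open import Defs
open import Data.Bool using (Bool; true; false)
open import Data.Empty using (⊥-elim)
open import Data.List using (List; []; _∷_; _++_; map)
open import Data.List.Properties using (map-++)
open import Data.List.Membership.Propositional using (_∈_; _∉_)
open import Data.List.Membership.Propositional.Properties using (∈-∃++; ∈-map⁺)
open import Data.List.Relation.Unary.Any using (here; there)
open import Data.List.Relation.Unary.All as All using (All)
open import Data.List.Relation.Unary.All.Properties using (++⁻ʳ)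
open import Data.List.Relation.Unary.Unique.Propositional using (Unique)
open import Data.List.Relation.Unary.Unique.Propositional.Properties using (Unique[x∷xs]⇒x∉xs)
open import Data.List.Relation.Binary.Permutation.Propositional.Properties using (∈-resp-↭; shift)
import Data.List.Relation.Binary.Permutation.Setoid.Properties as SetoidPermutation
open import Data.Maybe using (just)
open import Data.Nat using (zero; suc)
open import Data.Product using (Σ; ∃; _×_; _,_; proj₁; proj₂)
open import Data.Sum using (_⊎_; inj₁; inj₂)
open import Function using (_∘_)
open import Relation.Binary.Bundles using (Setoid)
open import Relation.Nullary using (¬_)
open import Relation.Binary.PropositionalEquality using (_≡_; refl; setoid)
import Relation.Binary.Reasoning.Setoid as SetoidReasoning

Unique-++-∷⇒∉ : ∀ {A : Set} xs {y : A} {ys} → Unique (xs ++ y ∷ ys) → y ∉ xs ++ ys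
Unique-++-∷⇒∉ {A} xs {y} {ys} u = Unique[x∷xs]⇒x∉xs (Unique-resp-↭ (shiftₛ refl xs ys) u)
  where open SetoidPermutation (setoid A) using (Unique-resp-↭) renaming (shift to shiftₛ)

Unique-map-++-∷⇒∉ : ∀ {A B : Set} (f : A → B) xs {y ys} →
                    Unique (map f (xs ++ y ∷ ys)) → f y ∉ map f (xs ++ ys)
Unique-map-++-∷⇒∉ f xs {y} {ys} u rewrite map-++ f xs (y ∷ ys) | map-++ f xs ys =
  Unique-++-∷⇒∉ (map f xs) u

module _ (Act : Set) where
  open Monitors Act

  private variable
    α : Label
    a : Act
    s : List Act
    x y : Var
    v : Verdict
    m n k m₁ u : Mon
    σ : Subst

  infix 4 _∈ᵛ_ _⊆ᵛ_ _≼_ _∼_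

  data _∈ᵛ_ (y : Var) : Mon → Set where
    hit : y ∈ᵛ var y
    ⊕ˡ  : y ∈ᵛ m → y ∈ᵛ m ⊕ n
    ⊕ʳ  : y ∈ᵛ n → y ∈ᵛ m ⊕ n

  _⊆ᵛ_ : Mon → Mon → Set
  m ⊆ᵛ n = ∀ {y} → y ∈ᵛ m → y ∈ᵛ n

  ∈ᵛ-[]⁻ : ∀ m → y ∈ᵛ (m [ σ ]) → ∃ λ z → z ∈ᵛ m × y ∈ᵛ σ z
  ∈ᵛ-[]⁻ (m ⊕ n) (⊕ˡ p) with z , z∈m , y∈σz ← ∈ᵛ-[]⁻ m p = z , ⊕ˡ z∈m , y∈σz
  ∈ᵛ-[]⁻ (m ⊕ n) (⊕ʳ p) with z , z∈n , y∈σz ← ∈ᵛ-[]⁻ n p = z , ⊕ʳ z∈n , y∈σz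
  ∈ᵛ-[]⁻ (var z) p = z , hit , p

  ∈ᵛ-[]⁺ : ∀ {z} → z ∈ᵛ m → y ∈ᵛ σ z → y ∈ᵛ (m [ σ ])
  ∈ᵛ-[]⁺ hit    p = p
  ∈ᵛ-[]⁺ (⊕ˡ q) p = ⊕ˡ (∈ᵛ-[]⁺ q p)
  ∈ᵛ-[]⁺ (⊕ʳ q) p = ⊕ʳ (∈ᵛ-[]⁺ q p)

  step-[]⁺ : m ─[ α ]→ m₁ → (m [ σ ]) ─[ α ]→ (m₁ [ σ ])
  step-[]⁺ pre       = pre
  step-[]⁺ (sumL st) = sumL (step-[]⁺ st)
  step-[]⁺ (sumR st) = sumR (step-[]⁺ st)
  step-[]⁺ vrd       = vrd

  ∈ᵛ-step-[] : y ∈ᵛ m → σ y ─[ α ]→ u → (m [ σ ]) ─[ α ]→ u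
  ∈ᵛ-step-[] hit    st = st
  ∈ᵛ-step-[] (⊕ˡ p) st = sumL (∈ᵛ-step-[] p st)
  ∈ᵛ-step-[] (⊕ʳ p) st = sumR (∈ᵛ-step-[] p st)

  step-[]⁻ : ∀ m → (m [ σ ]) ─[ α ]→ u →
             (∃ λ m₁ → m ─[ α ]→ m₁ × u ≡ (m₁ [ σ ])) ⊎ (∃ λ z → z ∈ᵛ m × σ z ─[ α ]→ u)
  step-[]⁻ (verd v) vrd = inj₁ (verd v , vrd , refl)
  step-[]⁻ (a · m)  pre = inj₁ (m , pre , refl)
  step-[]⁻ (m ⊕ n) (sumL st) with step-[]⁻ m st
  ... | inj₁ (m₁ , st′ , eq) = inj₁ (m₁ , sumL st′ , eq)
  ... | inj₂ (z , z∈m , st′) = inj₂ (z , ⊕ˡ z∈m , st′)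
  step-[]⁻ (m ⊕ n) (sumR st) with step-[]⁻ n st
  ... | inj₁ (n₁ , st′ , eq) = inj₁ (n₁ , sumR st′ , eq)
  ... | inj₂ (z , z∈n , st′) = inj₂ (z , ⊕ʳ z∈n , st′)
  step-[]⁻ (var z) st = inj₂ (z , hit , st)

  -- Unmatched steps into end must be allowed: A4 equates x + end, which can step, with x.
  _≼_ : Mon → Mon → Set
  m ≼ n = ∀ {α m₁} → m ─[ α ]→ m₁ →
          (∃ λ n₁ → n ─[ α ]→ n₁ × ACI ⊢ m₁ ≈ n₁) ⊎ ACI ⊢ m₁ ≈ endM

  ≼-refl : m ≼ m
  ≼-refl st = inj₁ (_ , st , refl)

  ≼-trans : m ≼ n → n ≼ k → m ≼ k
  ≼-trans m≼n n≼k st with m≼n st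
  ... | inj₂ m₁≈end = inj₂ m₁≈end
  ... | inj₁ (n₁ , st′ , m₁≈n₁) with n≼k st′
  ...   | inj₂ n₁≈end = inj₂ (trans m₁≈n₁ n₁≈end)
  ...   | inj₁ (k₁ , st″ , n₁≈k₁) = inj₁ (k₁ , st″ , trans m₁≈n₁ n₁≈k₁)

  ≼-⊕ : ∀ {m′ n′} → m ≼ m′ → n ≼ n′ → m ⊕ n ≼ m′ ⊕ n′
  ≼-⊕ m≼ n≼ (sumL st) with m≼ st
  ... | inj₁ (k , st′ , eq) = inj₁ (k , sumL st′ , eq)
  ... | inj₂ eq = inj₂ eq
  ≼-⊕ m≼ n≼ (sumR st) with n≼ st
  ... | inj₁ (k , st′ , eq) = inj₁ (k , sumR st′ , eq)
  ... | inj₂ eq = inj₂ eq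

  ≼-[] : ∀ σ → m ≼ n → m ⊆ᵛ n → (m [ σ ]) ≼ (n [ σ ])
  ≼-[] {m} σ m≼n m⊆n st with step-[]⁻ m st
  ... | inj₂ (z , z∈m , st′) = inj₁ (_ , ∈ᵛ-step-[] (m⊆n z∈m) st′ , refl)
  ... | inj₁ (m₁ , st′ , refl) with m≼n st′
  ...   | inj₁ (n₁ , st″ , m₁≈n₁) = inj₁ (n₁ [ σ ] , step-[]⁺ st″ , subst σ m₁≈n₁)
  ...   | inj₂ m₁≈end = inj₂ (subst σ m₁≈end)

  ⊆ᵛ-⊕ : ∀ {m′ n′} → m ⊆ᵛ m′ → n ⊆ᵛ n′ → m ⊕ n ⊆ᵛ m′ ⊕ n′
  ⊆ᵛ-⊕ m⊆ n⊆ (⊕ˡ p) = ⊕ˡ (m⊆ p)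
  ⊆ᵛ-⊕ m⊆ n⊆ (⊕ʳ p) = ⊕ʳ (n⊆ p)

  ⊆ᵛ-[] : ∀ σ → m ⊆ᵛ n → (m [ σ ]) ⊆ᵛ (n [ σ ])
  ⊆ᵛ-[] {m} σ m⊆n p with z , z∈m , y∈σz ← ∈ᵛ-[]⁻ m p = ∈ᵛ-[]⁺ (m⊆n z∈m) y∈σz

  record _∼_ (m n : Mon) : Set where
    field
      sim    : m ≼ n
      sim⁻¹  : n ≼ m
      vars   : m ⊆ᵛ n
      vars⁻¹ : n ⊆ᵛ m

  open _∼_

  ∼-sym : m ∼ n → n ∼ m
  ∼-sym p = record { sim = sim⁻¹ p ; sim⁻¹ = sim p ; vars = vars⁻¹ p ; vars⁻¹ = vars p }

  ACI-axiom⇒∼ : ACI m n → m ∼ n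
  ACI-axiom⇒∼ A1 = record
    { sim    = λ { (sumL ()) ; (sumR ()) }
    ; sim⁻¹  = λ { (sumL ()) ; (sumR ()) }
    ; vars   = λ { (⊕ˡ hit) → ⊕ʳ hit ; (⊕ʳ hit) → ⊕ˡ hit }
    ; vars⁻¹ = λ { (⊕ˡ hit) → ⊕ʳ hit ; (⊕ʳ hit) → ⊕ˡ hit } }
  ACI-axiom⇒∼ A2 = record
    { sim    = λ { (sumL ()) ; (sumR (sumL ())) ; (sumR (sumR ())) }
    ; sim⁻¹  = λ { (sumL (sumL ())) ; (sumL (sumR ())) ; (sumR ()) }
    ; vars   = λ { (⊕ˡ hit) → ⊕ˡ (⊕ˡ hit) ; (⊕ʳ (⊕ˡ hit)) → ⊕ˡ (⊕ʳ hit) ; (⊕ʳ (⊕ʳ hit)) → ⊕ʳ hit }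
    ; vars⁻¹ = λ { (⊕ˡ (⊕ˡ hit)) → ⊕ˡ hit ; (⊕ˡ (⊕ʳ hit)) → ⊕ʳ (⊕ˡ hit) ; (⊕ʳ hit) → ⊕ʳ (⊕ʳ hit) } }
  ACI-axiom⇒∼ A3 = record
    { sim    = λ { (sumL ()) ; (sumR ()) }
    ; sim⁻¹  = λ ()
    ; vars   = λ { (⊕ˡ hit) → hit ; (⊕ʳ hit) → hit }
    ; vars⁻¹ = λ { hit → ⊕ˡ hit } }
  ACI-axiom⇒∼ A4 = record
    { sim    = λ { (sumL ()) ; (sumR vrd) → inj₂ refl }
    ; sim⁻¹  = λ ()
    ; vars   = λ { (⊕ˡ hit) → hit }
    ; vars⁻¹ = λ { hit → ⊕ˡ hit } }

  ACI⇒∼ : ACI ⊢ m ≈ n → m ∼ n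
  ACI⇒∼ (ax a) = ACI-axiom⇒∼ a
  ACI⇒∼ refl = record { sim = ≼-refl ; sim⁻¹ = ≼-refl ; vars = λ p → p ; vars⁻¹ = λ p → p }
  ACI⇒∼ (sym d) = ∼-sym (ACI⇒∼ d)
  ACI⇒∼ (trans d e) = record
    { sim    = ≼-trans (sim p) (sim q)
    ; sim⁻¹  = ≼-trans (sim⁻¹ q) (sim⁻¹ p)
    ; vars   = vars q ∘ vars p
    ; vars⁻¹ = vars⁻¹ p ∘ vars⁻¹ q }
    where p = ACI⇒∼ d ; q = ACI⇒∼ e
  ACI⇒∼ (subst σ d) = record
    { sim    = ≼-[] σ (sim p) (vars p)
    ; sim⁻¹  = ≼-[] σ (sim⁻¹ p) (vars⁻¹ p)
    ; vars   = ⊆ᵛ-[] σ (vars p)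
    ; vars⁻¹ = ⊆ᵛ-[] σ (vars⁻¹ p) }
    where p = ACI⇒∼ d
  ACI⇒∼ (cong· a d) = record
    { sim    = λ { pre → inj₁ (_ , pre , d) }
    ; sim⁻¹  = λ { pre → inj₁ (_ , pre , sym d) }
    ; vars   = λ ()
    ; vars⁻¹ = λ () }
  ACI⇒∼ (cong⊕ d e) = record
    { sim    = ≼-⊕ (sim p) (sim q)
    ; sim⁻¹  = ≼-⊕ (sim⁻¹ p) (sim⁻¹ q)
    ; vars   = ⊆ᵛ-⊕ (vars p) (vars q)
    ; vars⁻¹ = ⊆ᵛ-⊕ (vars⁻¹ p) (vars⁻¹ q) }
    where p = ACI⇒∼ d ; q = ACI⇒∼ e

  ReachesVar-∷⁻ : ReachesVar m (a ∷ s) x → ∃ λ m₁ → m ─[ just a ]→ m₁ × ReachesVar m₁ s x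
  ReachesVar-∷⁻ (ms , t , step st r , t≈) = _ , st , (ms , t , r , t≈)

  ReachesVar-∷⁺ : m ─[ just a ]→ m₁ → ReachesVar m₁ s x → ReachesVar m (a ∷ s) x
  ReachesVar-∷⁺ st (ms , t , r , t≈) = ms , t , step st r , t≈

  ReachesVar-[]⁻ : ReachesVar m [] x → x ∈ᵛ m
  ReachesVar-[]⁻ (ms , t , done , t≈) = vars⁻¹ (ACI⇒∼ t≈) (⊕ˡ hit)

  verd-¬ReachesVar : ∀ s → ¬ ReachesVar (verd v) s x
  verd-¬ReachesVar [] r with () ← ReachesVar-[]⁻ r
  verd-¬ReachesVar (a ∷ s) r with _ , vrd , r₁ ← ReachesVar-∷⁻ r = verd-¬ReachesVar s r₁

  ReachesVar-resp-ACI : ∀ s → ACI ⊢ m ≈ n → ReachesVar m s x → ReachesVar n s x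
  ReachesVar-resp-ACI [] m≈n (ms , _ , done , t≈) = ms , _ , done , trans (sym m≈n) t≈
  ReachesVar-resp-ACI (a ∷ s) m≈n r with _ , st , r₁ ← ReachesVar-∷⁻ r with sim (ACI⇒∼ m≈n) st
  ... | inj₁ (_ , st′ , m₁≈n₁) = ReachesVar-∷⁺ st′ (ReachesVar-resp-ACI s m₁≈n₁ r₁)
  ... | inj₂ m₁≈end = ⊥-elim (verd-¬ReachesVar s (ReachesVar-resp-ACI s m₁≈end r₁))

  -- The variables x, y, z of the axioms are var 0, var 1, var 2.
  instantiate : Mon → Mon → Mon → Subst
  instantiate m n k zero          = m
  instantiate m n k (suc zero)    = n
  instantiate m n k (suc (suc _)) = k

  ⊕-comm : ∀ m n → ACI ⊢ (m ⊕ n) ≈ (n ⊕ m)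
  ⊕-comm m n = subst (instantiate m n m) (ax A1)

  ⊕-assoc : ∀ m n k → ACI ⊢ (m ⊕ (n ⊕ k)) ≈ ((m ⊕ n) ⊕ k)
  ⊕-assoc m n k = subst (instantiate m n k) (ax A2)

  ⊕-identityʳ : ∀ m → ACI ⊢ (m ⊕ endM) ≈ m
  ⊕-identityʳ m = subst (instantiate m m m) (ax A4)

  mn⊕k≈mk⊕n : ∀ m n k → ACI ⊢ ((m ⊕ n) ⊕ k) ≈ ((m ⊕ k) ⊕ n)
  mn⊕k≈mk⊕n m n k = trans (sym (⊕-assoc m n k)) (trans (cong⊕ refl (⊕-comm n k)) (⊕-assoc m k n))

  ·-distrib-⊕ : ∀ a m n → Ev ⊢ (a · (m ⊕ n)) ≈ ((a · m) ⊕ (a · n))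
  ·-distrib-⊕ a m n = subst (instantiate m n m) (ax (Da a))

  ACI⇒Ev : ACI ⊢ m ≈ n → Ev ⊢ m ≈ n
  ACI⇒Ev (ax a)      = ax (aci a)
  ACI⇒Ev refl        = refl
  ACI⇒Ev (sym d)     = sym (ACI⇒Ev d)
  ACI⇒Ev (trans d e) = trans (ACI⇒Ev d) (ACI⇒Ev e)
  ACI⇒Ev (subst σ d) = subst σ (ACI⇒Ev d)
  ACI⇒Ev (cong· a d) = cong· a (ACI⇒Ev d)
  ACI⇒Ev (cong⊕ d e) = cong⊕ (ACI⇒Ev d) (ACI⇒Ev e)

  ⊢-setoid : (Mon → Mon → Set) → Setoid _ _
  ⊢-setoid Ax = record
    { Carrier       = Mon
    ; _≈_           = Ax ⊢_≈_
    ; isEquivalence = record { refl = refl ; sym = sym ; trans = trans } }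

  ⨁ : {A : Set} → (A → Mon) → List A → Mon
  ⨁ f []      = endM
  ⨁ f (k ∷ l) = f k ⊕ ⨁ f l

  prefixed : Act × Mon → Mon
  prefixed p = proj₁ p · proj₂ p

  withVerdicts : Bool → Bool → Mon → Mon
  withVerdicts by bn m = opt bn no (opt by yes m)

  -- canon with Σ' replaced by the end-terminated fold ⨁, whose shape is uniform in the list.
  nf : List (Act × Mon) → List Var → Bool → Bool → Mon
  nf ps xs by bn = withVerdicts by bn (⨁ prefixed ps ⊕ ⨁ var xs)

  Σ'-map≈⨁ : ∀ {A : Set} (f : A → Mon) l → ACI ⊢ Σ' (map f l) ≈ ⨁ f l
  Σ'-map≈⨁ f []           = refl
  Σ'-map≈⨁ f (k ∷ [])     = sym (⊕-identityʳ (f k))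
  Σ'-map≈⨁ f (k ∷ k′ ∷ l) = cong⊕ refl (Σ'-map≈⨁ f (k′ ∷ l))

  opt-cong : ∀ {Ax} b v → Ax ⊢ m ≈ n → Ax ⊢ opt b v m ≈ opt b v n
  opt-cong true  v m≈n = cong⊕ m≈n refl
  opt-cong false v m≈n = m≈n

  opt-⊕ : ∀ b v m n → ACI ⊢ opt b v (m ⊕ n) ≈ (opt b v m ⊕ n)
  opt-⊕ true  v m n = mn⊕k≈mk⊕n m n (verd v)
  opt-⊕ false v m n = refl

  canon≈nf : ∀ ps xs by bn → ACI ⊢ canon ps xs by bn ≈ nf ps xs by bn
  canon≈nf ps xs by bn =
    opt-cong bn no (opt-cong by yes (cong⊕ (Σ'-map≈⨁ prefixed ps) (Σ'-map≈⨁ var xs)))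

  withVerdicts-⊕ : ∀ by bn → Ev ⊢ m ≈ (n ⊕ k) → Ev ⊢ withVerdicts by bn m ≈ (withVerdicts by bn n ⊕ k)
  withVerdicts-⊕ {m} {n} {k} by bn m≈n⊕k = begin
    opt bn no (opt by yes m)       ≈⟨ opt-cong bn no (opt-cong by yes m≈n⊕k) ⟩
    opt bn no (opt by yes (n ⊕ k)) ≈⟨ ACI⇒Ev (opt-cong bn no (opt-⊕ by yes n k)) ⟩
    opt bn no (opt by yes n ⊕ k)   ≈⟨ ACI⇒Ev (opt-⊕ bn no (opt by yes n) k) ⟩
    opt bn no (opt by yes n) ⊕ k   ∎
    where open SetoidReasoning (⊢-setoid Ev)

  ⨁-++-∷ : ∀ {A : Set} (f : A → Mon) l₁ {l₂ y} → ACI ⊢ ⨁ f (l₁ ++ y ∷ l₂) ≈ (⨁ f (l₁ ++ l₂) ⊕ f y)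
  ⨁-++-∷ f []       {l₂} {y} = ⊕-comm (f y) (⨁ f l₂)
  ⨁-++-∷ f (k ∷ l₁) {l₂} {y} =
    trans (cong⊕ refl (⨁-++-∷ f l₁)) (⊕-assoc (f k) (⨁ f (l₁ ++ l₂)) (f y))

  ⨁-prefixed-step : ∀ ps → ⨁ prefixed ps ─[ just a ]→ u → (a , u) ∈ ps ⊎ u ≡ endM
  ⨁-prefixed-step []       vrd        = inj₂ refl
  ⨁-prefixed-step (_ ∷ ps) (sumL pre) = inj₁ (here refl)
  ⨁-prefixed-step (_ ∷ ps) (sumR st) with ⨁-prefixed-step ps st
  ... | inj₁ au∈ps = inj₁ (there au∈ps)
  ... | inj₂ u≡end = inj₂ u≡end

  ⨁-var-step : ∀ xs → ⨁ var xs ─[ α ]→ u → u ≡ endM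
  ⨁-var-step []       vrd       = refl
  ⨁-var-step (_ ∷ xs) (sumR st) = ⨁-var-step xs st

  opt-step : ∀ b v → opt b v m ─[ α ]→ u → m ─[ α ]→ u ⊎ u ≡ verd v
  opt-step true  v (sumL st)  = inj₁ st
  opt-step true  v (sumR vrd) = inj₂ refl
  opt-step false v st         = inj₁ st

  nf-step : ∀ ps xs by bn → nf ps xs by bn ─[ just a ]→ u → (a , u) ∈ ps ⊎ ∃ λ v → u ≡ verd v
  nf-step ps xs by bn st with opt-step bn no st
  ... | inj₂ u≡no = inj₂ (no , u≡no)
  ... | inj₁ st₁ with opt-step by yes st₁
  ...   | inj₂ u≡yes = inj₂ (yes , u≡yes)
  ...   | inj₁ (sumR st₂) = inj₂ (end , ⨁-var-step xs st₂)
  ...   | inj₁ (sumL st₂) with ⨁-prefixed-step ps st₂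
  ...     | inj₁ au∈ps = inj₁ au∈ps
  ...     | inj₂ u≡end = inj₂ (end , u≡end)

  ⨁-var-∈ᵛ : ∀ xs → y ∈ᵛ ⨁ var xs → y ∈ xs
  ⨁-var-∈ᵛ (_ ∷ xs) (⊕ˡ hit) = here refl
  ⨁-var-∈ᵛ (_ ∷ xs) (⊕ʳ p)   = there (⨁-var-∈ᵛ xs p)

  ⨁-prefixed-∉ᵛ : ∀ ps → ¬ y ∈ᵛ ⨁ prefixed ps
  ⨁-prefixed-∉ᵛ (_ ∷ ps) (⊕ʳ p) = ⨁-prefixed-∉ᵛ ps p

  opt-∈ᵛ : ∀ b v → y ∈ᵛ opt b v m → y ∈ᵛ m
  opt-∈ᵛ true  v (⊕ˡ p) = p
  opt-∈ᵛ false v p      = p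

  nf-∈ᵛ : ∀ ps xs by bn → y ∈ᵛ nf ps xs by bn → y ∈ xs
  nf-∈ᵛ ps xs by bn p with opt-∈ᵛ by yes (opt-∈ᵛ bn no p)
  ... | ⊕ˡ q = ⊥-elim (⨁-prefixed-∉ᵛ ps q)
  ... | ⊕ʳ q = ⨁-var-∈ᵛ xs q

  SplitsOff : Mon → List Act → Var → Set
  SplitsOff m s x = Σ Mon λ m′ → (Ev ⊢ m ≈ (m′ ⊕ (s ∙ var x))) × ¬ ReachesVar m′ s x

  SplitsOff-resp-Ev : Ev ⊢ m ≈ n → SplitsOff n s x → SplitsOff m s x
  SplitsOff-resp-Ev m≈n (m′ , n≈ , ¬r) = m′ , trans m≈n n≈ , ¬r

  nf-remove-var : ∀ ps xs₁ {xs₂} by bn →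
                  Ev ⊢ nf ps (xs₁ ++ x ∷ xs₂) by bn ≈ (nf ps (xs₁ ++ xs₂) by bn ⊕ var x)
  nf-remove-var {x} ps xs₁ {xs₂} by bn = withVerdicts-⊕ by bn (ACI⇒Ev
    (trans (cong⊕ refl (⨁-++-∷ var xs₁)) (⊕-assoc (⨁ prefixed ps) (⨁ var (xs₁ ++ xs₂)) (var x))))

  nf-¬ReachesVar-[] : ∀ ps xs₁ {xs₂} by bn →
                      Unique (xs₁ ++ x ∷ xs₂) → ¬ ReachesVar (nf ps (xs₁ ++ xs₂) by bn) [] x
  nf-¬ReachesVar-[] ps xs₁ by bn vars-unique r =
    Unique-++-∷⇒∉ xs₁ vars-unique (nf-∈ᵛ ps _ by bn (ReachesVar-[]⁻ r))

  nf-remove-prefix : ∀ ps₁ {ps₂ n′} xs by bn → Ev ⊢ n ≈ (n′ ⊕ k) →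
                     Ev ⊢ nf (ps₁ ++ (a , n) ∷ ps₂) xs by bn ≈ (nf (ps₁ ++ (a , n′) ∷ ps₂) xs by bn ⊕ a · k)
  nf-remove-prefix {n} {k} {a} ps₁ {ps₂} {n′} xs by bn n≈n′⊕k = withVerdicts-⊕ by bn (begin
    ⨁ prefixed (ps₁ ++ (a , n) ∷ ps₂) ⊕ ⨁ var xs             ≈⟨ cong⊕ prefixes refl ⟩
    (⨁ prefixed (ps₁ ++ (a , n′) ∷ ps₂) ⊕ a · k) ⊕ ⨁ var xs  ≈⟨ ACI⇒Ev (mn⊕k≈mk⊕n _ _ _) ⟩
    (⨁ prefixed (ps₁ ++ (a , n′) ∷ ps₂) ⊕ ⨁ var xs) ⊕ a · k  ∎)
    where
    open SetoidReasoning (⊢-setoid Ev)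
    rest : Mon
    rest = ⨁ prefixed (ps₁ ++ ps₂)
    prefixes : Ev ⊢ ⨁ prefixed (ps₁ ++ (a , n) ∷ ps₂) ≈ (⨁ prefixed (ps₁ ++ (a , n′) ∷ ps₂) ⊕ a · k)
    prefixes = begin
      ⨁ prefixed (ps₁ ++ (a , n) ∷ ps₂)            ≈⟨ ACI⇒Ev (⨁-++-∷ prefixed ps₁) ⟩
      rest ⊕ a · n                                  ≈⟨ cong⊕ refl (cong· a n≈n′⊕k) ⟩
      rest ⊕ a · (n′ ⊕ k)                           ≈⟨ cong⊕ refl (·-distrib-⊕ a n′ k) ⟩
      rest ⊕ (a · n′ ⊕ a · k)                       ≈⟨ ACI⇒Ev (⊕-assoc rest (a · n′) (a · k)) ⟩
      (rest ⊕ a · n′) ⊕ a · k                       ≈⟨ cong⊕ (ACI⇒Ev (sym (⨁-++-∷ prefixed ps₁))) refl ⟩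
      ⨁ prefixed (ps₁ ++ (a , n′) ∷ ps₂) ⊕ a · k   ∎

  nf-¬ReachesVar-∷ : ∀ ps₁ {ps₂ n′} xs by bn → Unique (map proj₁ (ps₁ ++ (a , n) ∷ ps₂)) →
                     ¬ ReachesVar n′ s x → ¬ ReachesVar (nf (ps₁ ++ (a , n′) ∷ ps₂) xs by bn) (a ∷ s) x
  nf-¬ReachesVar-∷ {s = s} ps₁ {ps₂} xs by bn keys-unique ¬r r
    with _ , st , r₁ ← ReachesVar-∷⁻ r
    with nf-step (ps₁ ++ _ ∷ ps₂) xs by bn st
  ... | inj₂ (_ , refl) = verd-¬ReachesVar s r₁
  ... | inj₁ au∈ps with ∈-resp-↭ (shift _ ps₁ ps₂) au∈ps
  ...   | here refl = ¬r r₁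
  ...   | there au∈ps₁++ps₂ = Unique-map-++-∷⇒∉ proj₁ ps₁ keys-unique (∈-map⁺ proj₁ au∈ps₁++ps₂)

  mutual
    ONF-splitsOff : ∀ s → IsONF m → ReachesVar m s x → SplitsOff m s x
    ONF-splitsOff s (onf ps keys-unique _ onfs xs vars-unique by bn m≈canon) r =
      SplitsOff-resp-Ev (ACI⇒Ev m≈nf)
        (nf-splitsOff s ps keys-unique onfs xs vars-unique by bn (ReachesVar-resp-ACI s m≈nf r))
      where m≈nf = trans m≈canon (canon≈nf ps xs by bn)

    nf-splitsOff : ∀ s ps → Unique (map proj₁ ps) → All (IsONF ∘ proj₂) ps →
                   ∀ xs → Unique xs → ∀ by bn →
                   ReachesVar (nf ps xs by bn) s x → SplitsOff (nf ps xs by bn) s x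
    nf-splitsOff [] ps _ _ xs vars-unique by bn r
      with xs₁ , xs₂ , refl ← ∈-∃++ (nf-∈ᵛ ps xs by bn (ReachesVar-[]⁻ r))
      = nf ps (xs₁ ++ xs₂) by bn , nf-remove-var ps xs₁ by bn , nf-¬ReachesVar-[] ps xs₁ by bn vars-unique
    nf-splitsOff (a ∷ s) ps keys-unique onfs xs _ by bn r
      with _ , st , r₁ ← ReachesVar-∷⁻ r
      with nf-step ps xs by bn st
    ... | inj₂ (_ , refl) = ⊥-elim (verd-¬ReachesVar s r₁)
    ... | inj₁ au∈ps
      with ps₁ , ps₂ , refl ← ∈-∃++ au∈ps
      with n′ , n≈ , ¬r ← ONF-splitsOff s (All.head (++⁻ʳ ps₁ onfs)) r₁
      = nf (ps₁ ++ (a , n′) ∷ ps₂) xs by bn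
      , nf-remove-prefix ps₁ xs by bn n≈
      , nf-¬ReachesVar-∷ ps₁ xs by bn keys-unique ¬r

lemma15 : (Act : Set) → let open Monitors Act in
    (m : Mon) → IsONF m → (s : List Act) → (x : Var) →
    ReachesVar m s x →
    Σ Mon (λ m' → (Ev ⊢ m ≈ (m' ⊕ (s ∙ var x))) × ¬ ReachesVar m' s x)
lemma15 Act m m-onf s x = ONF-splitsOff Act s m-onf
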